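{- Let $n, R, m$ be positive integers and let $\mathcal{U}=(u_{klr})$, $\mathcal{V}=(v_{klr})$, $\mathcal{W}=(w_{ijr})$ be real tensors of size $n\times n\times R$. For $\mathbf{A},\mathbf{B}\in\mathbb{R}^{mn\times mn}$, partitioned into $n\times n$ arrays of $m\times m$ blocks $\mathbf{A}_{kl}$, $\mathbf{B}_{k'l'}$, define $f(\mathbf{A},\mathbf{B})\in\mathbb{R}^{mn\times mn}$ blockwise by $$f(\mathbf{A},\mathbf{B})_{ij}=\sum_{r=1}^R w_{ijr}\Big(\sum_{k,l=1}^n u_{klr}\mathbf{A}_{kl}\Big)\Big(\sum_{k',l'=1}^n v_{k'l'r}\mathbf{B}_{k'l'}\Big),\quad i,j\in[n].$$ Let $\kappa=\frac{1}{n^3}\sum_{(i,j,l)\in[n]^3}\big(1-\sum_{r=1}^R u_{ilr}v_{ljr}w_{ijr}\big)$ and assume $\kappa\neq 1$. Let $\hat f(\mathbf{A},\mathbf{B})=(1-\kappa)^{ -1}\mathbf{M}_1^\top f(\mathbf{M}_1\mathbf{A}\mathbf{M}_2^\top,\mathbf{M}_2\mathbf{B}\mathbf{M}_3^\top)\mathbf{M}_3$ be the randomized computation described in the context. Then for all $\mathbf{A},\mathbf{B}\in\mathbb{R}^{mn\times mn}$, $\mathbb{E}[\hat f(\mathbf{A},\mathbf{B})]=\mathbf{A}\mathbf{B}$.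
   Context: $[n]=\{1,\dots,n\}$. Randomization: $\{s_i(j)\}_{(i,j)\in[3]\times[n]}$ are i.i.d. Rademacher random variables ($\mathbb{P}[s_i(j)=1]=\mathbb{P}[s_i(j)=-1]=1/2$); $\pi_1,\pi_2,\pi_3:[n]\to[n]$ are independent random permutations (independent of the signs), each satisfying $\mathbb{P}[\pi_i(j)=k]=1/n$ for all $j,k\in[n]$. $\mathbf{S}_i\in\mathbb{R}^{mn\times mn}$ is block diagonal with $j$-th diagonal $m\times m$ block equal to $s_i(j)\mathbf{I}_m$; $\mathbf{P}_i\in\mathbb{R}^{mn\times mn}$ is the block permutation matrix whose $m\times m$ block in position $(\pi_i(j),j)$ is $\mathbf{I}_m$ for each $j\in[n]$, all other blocks zero; $\mathbf{M}_i=\mathbf{P}_i\mathbf{S}_i$, $i\in[3]$. The expectation is over these random variables, and arithmetic is exact. -}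

module Defs where

open import Level using (Level; _⊔_) renaming (suc to lsuc)
open import Algebra.Bundles using (CommutativeRing)
open import Relation.Binary.Core using (Rel)
open import Relation.Binary.Structures using (IsTotalOrder)
open import Relation.Nullary using (¬_; does)
open import Data.Bool using (Bool; true; false; if_then_else_)
open import Data.Nat using (ℕ; zero; suc; NonZero)
open import Data.Fin using (Fin; _≟_)
import Data.Fin as Fin
import Algebra.Properties.AbelianGroup
open import Data.Fin.Permutation using (Permutation′; _⟨$⟩ʳ_)
open import Data.Vec.Functional using () renaming (_∷_ to _∷ᶠ_)
open import Data.List using (List; []; _∷_; map)
open import Data.List.Relation.Unary.All using (All)
open import Data.Product using (_×_; _,_; proj₁; proj₂)

-- An ordered field (ℝ is an instance).  We keep the axioms we need to
-- speak about probabilities (an order, for nonnegativity) and division.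
-- `char0` is redundant for ordered fields but stated for convenience.

ℕ→ᴿ : {c ℓ : Level} (R : CommutativeRing c ℓ) → ℕ → CommutativeRing.Carrier R
ℕ→ᴿ R zero    = CommutativeRing.0# R
ℕ→ᴿ R (suc k) = CommutativeRing._+_ R (CommutativeRing.1# R) (ℕ→ᴿ R k)

record OrderedField (c ℓ : Level) : Set (lsuc (c ⊔ ℓ)) where
  field
    cRing : CommutativeRing c ℓ
  open CommutativeRing cRing public
  field
    _≤_          : Rel Carrier ℓ
    isTotalOrder : IsTotalOrder _≈_ _≤_
    +-mono-≤     : ∀ {x y} z → x ≤ y → (x + z) ≤ (y + z)
    *-nonneg     : ∀ {x y} → 0# ≤ x → 0# ≤ y → 0# ≤ (x * y)
    1≉0          : ¬ (1# ≈ 0#)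
    inv          : (x : Carrier) → ¬ (x ≈ 0#) → Carrier
    inv-inverse  : ∀ x (p : ¬ (x ≈ 0#)) → (x * inv x p) ≈ 1#

    char0        : ∀ k → ¬ (ℕ→ᴿ cRing (suc k) ≈ 0#)

  ℕ→ : ℕ → Carrier
  ℕ→ = ℕ→ᴿ cRing

module FieldDefs {c ℓ : Level} (F : OrderedField c ℓ) where
  open OrderedField F public

  ℕ→≉0 : (k : ℕ) → .{{NonZero k}} → ¬ (ℕ→ k ≈ 0#)
  ℕ→≉0 (suc k) = char0 k

  Σ[_] : (k : ℕ) → (Fin k → Carrier) → Carrier
  Σ[ zero ] f  = 0#
  Σ[ suc k ] f = f Fin.zero + Σ[ k ] (λ i → f (Fin.suc i))

  sumL : List Carrier → Carrier
  sumL []       = 0#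
  sumL (x ∷ xs) = x + sumL xs

  δ : {k : ℕ} → Fin k → Fin k → Carrier
  δ p q = if does (p ≟ q) then 1# else 0#

  -- An (mn × mn) matrix, indexed by (block row, row inside block,
  -- block column, column inside block): row (i,a) ↦ (i-1)m + a.
  BMat : ℕ → ℕ → Set c
  BMat n m = Fin n → Fin m → Fin n → Fin m → Carrier

  Mat : ℕ → Set c
  Mat m = Fin m → Fin m → Carrier

  _⊗_ : {n m : ℕ} → BMat n m → BMat n m → BMat n m
  _⊗_ {n} {m} A B i a j b = Σ[ n ] λ k → Σ[ m ] λ e → A i a k e * B k e j b

  _ᵀ : {n m : ℕ} → BMat n m → BMat n m
  (A ᵀ) i a j b = A j b i a

  scale : {n m : ℕ} → Carrier → BMat n m → BMat n m
  scale x A i a j b = x * A i a j b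

  block : {n m : ℕ} → BMat n m → Fin n → Fin n → Mat m
  block A k l a b = A k a l b

  _·_ : {m : ℕ} → Mat m → Mat m → Mat m
  _·_ {m} X Y a b = Σ[ m ] λ e → X a e * Y e b

  Tensor : ℕ → ℕ → Set c
  Tensor n R = Fin n → Fin n → Fin R → Carrier

  fAlg : {n R m : ℕ} → Tensor n R → Tensor n R → Tensor n R →
         BMat n m → BMat n m → BMat n m
  fAlg {n} {R} {m} U V W A B i a j b =
    Σ[ R ] λ r → W i j r *
      ((λ a′ b′ → Σ[ n ] λ k → Σ[ n ] λ l → U k l r * block A k l a′ b′)
       · (λ a′ b′ → Σ[ n ] λ k → Σ[ n ] λ l → V k l r * block B k l a′ b′)) a b

  κ : {n R : ℕ} → .{{NonZero n}} → Tensor n R → Tensor n R → Tensor n R → Carrier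
  κ {n} {R} U V W =
    (n⁻¹ * n⁻¹ * n⁻¹)
      * (Σ[ n ] λ i → Σ[ n ] λ j → Σ[ n ] λ l →
           1# - (Σ[ R ] λ r → U i l r * V l j r * W i j r))
    where n⁻¹ = inv (ℕ→ n) (ℕ→≉0 n)

  sgn : Bool → Carrier
  sgn true  = 1#
  sgn false = - 1#

  -- M = P S with S = blockdiag(s(j) I_m) and P having I_m in block (π(j), j):
  -- M_{(p,a),(q,b)} = Σ_{(r,e)} P_{(p,a),(r,e)} S_{(r,e),(q,b)}
  Smat : {n m : ℕ} → (Fin n → Bool) → BMat n m
  Smat s p a q b = δ p q * δ a b * sgn (s q)

  Pmat : {n m : ℕ} → Permutation′ n → BMat n m
  Pmat π p a q b = δ (π ⟨$⟩ʳ q) p * δ a b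

  Mmat : {n m : ℕ} → Permutation′ n → (Fin n → Bool) → BMat n m
  Mmat π s = Pmat π ⊗ Smat s

  -- Expectation over i.i.d. Rademacher signs s(0),…,s(k-1).
  half : Carrier
  half = inv (ℕ→ 2) (char0 1)

  Esign : (k : ℕ) → ((Fin k → Bool) → Carrier) → Carrier
  Esign zero    G = G (λ ())
  Esign (suc k) G = half * (Esign k (λ s → G (true ∷ᶠ s)) + Esign k (λ s → G (false ∷ᶠ s)))

  record PermDist (n : ℕ) .{{_ : NonZero n}} : Set (c ⊔ ℓ) where
    field
      support  : List (Permutation′ n × Carrier)
      nonneg   : All (λ x → 0# ≤ proj₂ x) support
      total    : sumL (map proj₂ support) ≈ 1#
      marginal : ∀ (j k : Fin n) →
                 sumL (map (λ x → δ (proj₁ x ⟨$⟩ʳ j) k * proj₂ x) support)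
                   ≈ inv (ℕ→ n) (ℕ→≉0 n)

  Eperm : {n : ℕ} .{{_ : NonZero n}} → PermDist n → (Permutation′ n → Carrier) → Carrier
  Eperm μ G = sumL (map (λ x → proj₂ x * G (proj₁ x)) (PermDist.support μ))

  fHat : {n R m : ℕ} → Tensor n R → Tensor n R → Tensor n R →
         (c⁻¹ : Carrier) →
         Permutation′ n → Permutation′ n → Permutation′ n →
         (Fin n → Bool) → (Fin n → Bool) → (Fin n → Bool) →
         BMat n m → BMat n m → BMat n m
  fHat U V W c⁻¹ π₁ π₂ π₃ s₁ s₂ s₃ A B =
    scale c⁻¹ (((M₁ ᵀ) ⊗ fAlg U V W ((M₁ ⊗ A) ⊗ (M₂ ᵀ)) ((M₂ ⊗ B) ⊗ (M₃ ᵀ))) ⊗ M₃)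
    where
      M₁ = Mmat π₁ s₁
      M₂ = Mmat π₂ s₂
      M₃ = Mmat π₃ s₃

  EfHat : {n R m : ℕ} .{{_ : NonZero n}} → Tensor n R → Tensor n R → Tensor n R →
          (c⁻¹ : Carrier) → PermDist n → PermDist n → PermDist n →
          BMat n m → BMat n m → BMat n m
  EfHat {n} U V W c⁻¹ μ₁ μ₂ μ₃ A B i a j b =
    Eperm μ₁ λ π₁ → Eperm μ₂ λ π₂ → Eperm μ₃ λ π₃ →
    Esign n λ s₁ → Esign n λ s₂ → Esign n λ s₃ →
    fHat U V W c⁻¹ π₁ π₂ π₃ s₁ s₂ s₃ A B i a j b

  1-κ≉0 : ∀ {κ′ : Carrier} → ¬ (κ′ ≈ 1#) → ¬ ((1# - κ′) ≈ 0#)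
  1-κ≉0 {κ′} h e = h (sym (AG.x∙y⁻¹≈ε⇒x≈y 1# κ′ e))
    where module AG = Algebra.Properties.AbelianGroup +-abelianGroup

module Submission where

-- Conjugating by Mᵢ = Pᵢ Sᵢ turns each entry of f̂(A, B) into a sum over block indices whose terms carry
-- products of six Rademacher signs. Since E[s sᵀ] = I, averaging the signs keeps exactly the terms
-- A_{il} B_{lj} of the block product, each weighted by the Brent coefficient
-- Σ_r u_{π₁(i)π₂(l)r} v_{π₂(l)π₃(j)r} w_{π₁(i)π₃(j)r}. Each πₖ maps a fixed index to a uniform one, so
-- averaging the permutations turns that weight into its mean over [n]³, which is 1 − κ and is cancelled
-- by the prefactor (1 − κ)⁻¹.

open import Defs
open import Level using (Level; _⊔_)
open import Function using (_∘_)
open import Relation.Nullary using (¬_)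
open import Data.Nat using (ℕ; NonZero; zero; suc)
open import Data.Fin using (Fin) renaming (zero to fzero; suc to fsuc)
open import Data.Bool using (Bool; true; false)
open import Data.List using (List; []; _∷_; map)
open import Data.Product using (_×_; _,_; proj₁; proj₂)
open import Data.Fin.Permutation using (Permutation′; _⟨$⟩ʳ_)
open import Data.Vec.Functional using () renaming (_∷_ to _∷ᶠ_)
import Algebra.Properties.Ring
import Algebra.Properties.AbelianGroup
import Algebra.Properties.Semiring.Sum
import Algebra.Solver.CommutativeMonoid
import Algebra.Properties.CommutativeSemigroup
import Relation.Binary.Reasoning.Setoid

module UnbiasedAlgorithm {c ℓ : Level} (𝔽 : OrderedField c ℓ) where
  open FieldDefs 𝔽
  open Relation.Binary.Reasoning.Setoid setoid
  open Algebra.Properties.Semiring.Sum semiring using (sum; sum-cong-≋; ∑-distrib-+; *-distribˡ-sum)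
  open Algebra.Properties.Ring ring using (-1*x≈-x; -‿involutive)
  open Algebra.Properties.AbelianGroup +-abelianGroup using (⁻¹-anti-homo‿-; xyx⁻¹≈y)
  module ×-Solver = Algebra.Solver.CommutativeMonoid *-commutativeMonoid
  module × = Algebra.Properties.CommutativeSemigroup *-commutativeSemigroup
  open Algebra.Properties.CommutativeSemigroup +-commutativeSemigroup using (interchange)
  open ×-Solver using (_⊕_; _⊜_)

  -- Σ[_] unfolds exactly like the library's sum, so the library's summation lemmas transfer.
  Σ≈sum : ∀ k (f : Fin k → Carrier) → Σ[ k ] f ≈ sum f
  Σ≈sum zero    f = refl
  Σ≈sum (suc k) f = +-congˡ (Σ≈sum k (f ∘ fsuc))

  Σ-cong : ∀ k {f g : Fin k → Carrier} → (∀ i → f i ≈ g i) → Σ[ k ] f ≈ Σ[ k ] g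
  Σ-cong k {f} {g} f≈g = begin
    Σ[ k ] f ≈⟨ Σ≈sum k f ⟩
    sum f    ≈⟨ sum-cong-≋ f≈g ⟩
    sum g    ≈⟨ Σ≈sum k g ⟨
    Σ[ k ] g ∎

  Σ-distrib-+ : ∀ k (f g : Fin k → Carrier) → Σ[ k ] (λ i → f i + g i) ≈ Σ[ k ] f + Σ[ k ] g
  Σ-distrib-+ k f g = begin
    Σ[ k ] (λ i → f i + g i) ≈⟨ Σ≈sum k _ ⟩
    sum (λ i → f i + g i)    ≈⟨ ∑-distrib-+ f g ⟩
    sum f + sum g            ≈⟨ +-cong (Σ≈sum k f) (Σ≈sum k g) ⟨
    Σ[ k ] f + Σ[ k ] g      ∎

  *-distribˡ-Σ : ∀ k x (f : Fin k → Carrier) → x * Σ[ k ] f ≈ Σ[ k ] (λ i → x * f i)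
  *-distribˡ-Σ k x f = begin
    x * Σ[ k ] f             ≈⟨ *-congˡ (Σ≈sum k f) ⟩
    x * sum f                ≈⟨ *-distribˡ-sum x f ⟩
    sum (λ i → x * f i)      ≈⟨ Σ≈sum k _ ⟨
    Σ[ k ] (λ i → x * f i)   ∎

  Σ-const : ∀ k x → Σ[ k ] (λ _ → x) ≈ ℕ→ k * x
  Σ-const zero    x = sym (zeroˡ x)
  Σ-const (suc k) x = begin
    x + Σ[ k ] (λ _ → x)  ≈⟨ +-cong (sym (*-identityˡ x)) (Σ-const k x) ⟩
    1# * x + ℕ→ k * x     ≈⟨ distribʳ x 1# (ℕ→ k) ⟨
    ℕ→ (suc k) * x        ∎

  Σ-δ-head : ∀ k (f : Fin (suc k) → Carrier) → 1# * f fzero + Σ[ k ] (λ i → 0# * f (fsuc i)) ≈ f fzero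
  Σ-δ-head k f = begin
    1# * f fzero + Σ[ k ] (λ i → 0# * f (fsuc i)) ≈⟨ +-cong (*-identityˡ _) (Σ-cong k λ i → zeroˡ _) ⟩
    f fzero + Σ[ k ] (λ _ → 0#)                   ≈⟨ +-congˡ (Σ-const k 0#) ⟩
    f fzero + ℕ→ k * 0#                           ≈⟨ +-congˡ (zeroʳ _) ⟩
    f fzero + 0#                                  ≈⟨ +-identityʳ _ ⟩
    f fzero                                       ∎

  Σ-δˡ : ∀ k (p : Fin k) (f : Fin k → Carrier) → Σ[ k ] (λ i → δ p i * f i) ≈ f p
  Σ-δˡ (suc k) fzero    f = Σ-δ-head k f
  Σ-δˡ (suc k) (fsuc p) f = trans (+-cong (zeroˡ _) (Σ-δˡ k p (f ∘ fsuc))) (+-identityˡ _)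

  Σ-δʳ : ∀ k (p : Fin k) (f : Fin k → Carrier) → Σ[ k ] (λ i → δ i p * f i) ≈ f p
  Σ-δʳ (suc k) fzero    f = Σ-δ-head k f
  Σ-δʳ (suc k) (fsuc p) f = trans (+-cong (zeroˡ _) (Σ-δʳ k p (f ∘ fsuc))) (+-identityˡ _)

  record IsLinear {X : Set} (E : (X → Carrier) → Carrier) : Set (c ⊔ ℓ) where
    field
      E-cong : ∀ {f g : X → Carrier} → (∀ x → f x ≈ g x) → E f ≈ E g
      E-+    : ∀ (f g : X → Carrier) → E (λ x → f x + g x) ≈ E f + E g
      E-*ˡ   : ∀ a (f : X → Carrier) → E (λ x → a * f x) ≈ a * E f

    E-*ʳ : ∀ a (f : X → Carrier) → E (λ x → f x * a) ≈ E f * a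
    E-*ʳ a f = trans (E-cong λ x → *-comm (f x) a) (trans (E-*ˡ a f) (*-comm a (E f)))

    E-0 : E (λ _ → 0#) ≈ 0#
    E-0 = trans (E-cong λ _ → sym (zeroˡ 0#)) (trans (E-*ˡ 0# λ _ → 0#) (zeroˡ _))

    E-sub : ∀ (f g : X → Carrier) → E (λ x → f x - g x) ≈ E f - E g
    E-sub f g = begin
      E (λ x → f x - g x)         ≈⟨ E-+ f (λ x → - g x) ⟩
      E f + E (λ x → - g x)       ≈⟨ +-congˡ (E-cong λ x → -1*x≈-x (g x)) ⟨
      E f + E (λ x → - 1# * g x)  ≈⟨ +-congˡ (E-*ˡ (- 1#) g) ⟩
      E f + - 1# * E g            ≈⟨ +-congˡ (-1*x≈-x (E g)) ⟩
      E f - E g                   ∎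

    E-Σ : ∀ k (f : X → Fin k → Carrier) → E (λ x → Σ[ k ] (f x)) ≈ Σ[ k ] (λ i → E (λ x → f x i))
    E-Σ zero    f = E-0
    E-Σ (suc k) f = trans (E-+ _ _) (+-congˡ (E-Σ k λ x i → f x (fsuc i)))

  Σ-isLinear : ∀ k → IsLinear (Σ[ k ])
  Σ-isLinear k = record
    { E-cong = Σ-cong k
    ; E-+    = Σ-distrib-+ k
    ; E-*ˡ   = λ a f → sym (*-distribˡ-Σ k a f)
    }

  Σ-comm : ∀ k l (f : Fin k → Fin l → Carrier) →
           Σ[ k ] (λ i → Σ[ l ] (f i)) ≈ Σ[ l ] (λ j → Σ[ k ] (λ i → f i j))
  Σ-comm k l = IsLinear.E-Σ (Σ-isLinear k) l

  *-distribʳ-Σ : ∀ k x (f : Fin k → Carrier) → Σ[ k ] f * x ≈ Σ[ k ] (λ i → f i * x)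
  *-distribʳ-Σ k x f = sym (IsLinear.E-*ʳ (Σ-isLinear k) x f)

  Σ-δ-reindex : ∀ k (f : Fin k → Fin k) (g h : Fin k → Carrier) →
                Σ[ k ] (λ l → g l * Σ[ k ] (λ q → δ (f q) l * h q)) ≈ Σ[ k ] (λ q → g (f q) * h q)
  Σ-δ-reindex k f g h = begin
    Σ[ k ] (λ l → g l * Σ[ k ] (λ q → δ (f q) l * h q))  ≈⟨ Σ-cong k (λ l → *-distribˡ-Σ k (g l) _) ⟩
    Σ[ k ] (λ l → Σ[ k ] (λ q → g l * (δ (f q) l * h q))) ≈⟨ Σ-comm k k _ ⟩
    Σ[ k ] (λ q → Σ[ k ] (λ l → g l * (δ (f q) l * h q))) ≈⟨ Σ-cong k (λ q → Σ-cong k λ l → ×.x∙yz≈y∙xz _ _ _) ⟩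
    Σ[ k ] (λ q → Σ[ k ] (λ l → δ (f q) l * (g l * h q))) ≈⟨ Σ-cong k (λ q → Σ-δˡ k (f q) _) ⟩
    Σ[ k ] (λ q → g (f q) * h q)                          ∎

  scaled-isLinear : ∀ {X : Set} {E : (X → Carrier) → Carrier} a → IsLinear E → IsLinear (λ f → a * E f)
  scaled-isLinear {E = E} a L = record
    { E-cong = λ f≈g → *-congˡ (E-cong f≈g)
    ; E-+    = λ f g → trans (*-congˡ (E-+ f g)) (distribˡ a (E f) (E g))
    ; E-*ˡ   = λ b f → trans (*-congˡ (E-*ˡ b f)) (×.x∙yz≈y∙xz a b (E f))
    }
    where open IsLinear L

  nested : ∀ {X Y : Set} → ((X → Carrier) → Carrier) → ((Y → Carrier) → Carrier) → (X × Y → Carrier) → Carrier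
  nested E₁ E₂ G = E₁ λ x → E₂ λ y → G (x , y)

  nested-isLinear : ∀ {X Y : Set} {E₁ : (X → Carrier) → Carrier} {E₂ : (Y → Carrier) → Carrier} →
                    IsLinear E₁ → IsLinear E₂ → IsLinear (nested E₁ E₂)
  nested-isLinear L₁ L₂ = record
    { E-cong = λ f≈g → L₁.E-cong λ x → L₂.E-cong λ y → f≈g (x , y)
    ; E-+    = λ f g → trans (L₁.E-cong λ x → L₂.E-+ _ _) (L₁.E-+ _ _)
    ; E-*ˡ   = λ a f → trans (L₁.E-cong λ x → L₂.E-*ˡ a _) (L₁.E-*ˡ a _)
    }
    where module L₁ = IsLinear L₁
          module L₂ = IsLinear L₂

  module _ (n : ℕ) .{{_ : NonZero n}} where

    n⁻¹ : Carrier
    n⁻¹ = inv (ℕ→ n) (ℕ→≉0 n)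

    uniform : (Fin n → Carrier) → Carrier
    uniform f = n⁻¹ * Σ[ n ] f

    uniform-isLinear : IsLinear uniform
    uniform-isLinear = scaled-isLinear n⁻¹ (Σ-isLinear n)

    uniform-const : ∀ x → uniform (λ _ → x) ≈ x
    uniform-const x = begin
      n⁻¹ * Σ[ n ] (λ _ → x) ≈⟨ *-congˡ (Σ-const n x) ⟩
      n⁻¹ * (ℕ→ n * x)       ≈⟨ *-assoc _ _ _ ⟨
      n⁻¹ * ℕ→ n * x         ≈⟨ *-congʳ (trans (*-comm _ _) (inv-inverse (ℕ→ n) (ℕ→≉0 n))) ⟩
      1# * x                 ≈⟨ *-identityˡ x ⟩
      x                      ∎

    E-uniform-comm : ∀ {X : Set} {E : (X → Carrier) → Carrier} → IsLinear E → ∀ (f : X → Fin n → Carrier) →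
                     E (λ x → uniform (f x)) ≈ uniform (λ i → E (λ x → f x i))
    E-uniform-comm L f = trans (E-*ˡ n⁻¹ _) (*-congˡ (E-Σ n f))
      where open IsLinear L

  -- Averages over permutations

  weighted : ∀ {X : Set} → List (X × Carrier) → (X → Carrier) → Carrier
  weighted L G = sumL (map (λ x → proj₂ x * G (proj₁ x)) L)

  weighted-isLinear : ∀ {X : Set} (L : List (X × Carrier)) → IsLinear (weighted L)
  weighted-isLinear []             = record
    { E-cong = λ _ → refl ; E-+ = λ _ _ → sym (+-identityˡ 0#) ; E-*ˡ = λ a _ → sym (zeroʳ a) }
  weighted-isLinear ((x , w) ∷ L) = record
    { E-cong = λ f≈g → +-cong (*-congˡ (f≈g x)) (E-cong f≈g)
    ; E-+    = λ f g → trans (+-cong (distribˡ w (f x) (g x)) (E-+ f g)) (interchange _ _ _ _)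
    ; E-*ˡ   = λ a f → trans (+-cong (×.x∙yz≈y∙xz w a (f x)) (E-*ˡ a f)) (sym (distribˡ a _ _))
    }
    where open IsLinear (weighted-isLinear L)

  sumL-map-cong : ∀ {a} {X : Set a} {f g : X → Carrier} (L : List X) → (∀ x → f x ≈ g x) → sumL (map f L) ≈ sumL (map g L)
  sumL-map-cong []      f≈g = refl
  sumL-map-cong (x ∷ L) f≈g = +-cong (f≈g x) (sumL-map-cong L f≈g)

  Eperm-marginal : ∀ {n} .{{_ : NonZero n}} (μ : PermDist n) j (G : Fin n → Carrier) →
                   Eperm μ (λ π → G (π ⟨$⟩ʳ j)) ≈ uniform n G
  Eperm-marginal {n} μ j G = begin
    Eperm μ (λ π → G (π ⟨$⟩ʳ j))                          ≈⟨ E-cong (λ π → Σ-δˡ n (π ⟨$⟩ʳ j) G) ⟨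
    Eperm μ (λ π → Σ[ n ] λ k → δ (π ⟨$⟩ʳ j) k * G k)      ≈⟨ E-Σ n _ ⟩
    Σ[ n ] (λ k → Eperm μ (λ π → δ (π ⟨$⟩ʳ j) k * G k))    ≈⟨ Σ-cong n (λ k → trans (E-*ʳ (G k) _) (*-congʳ (marginal-δ k))) ⟩
    Σ[ n ] (λ k → n⁻¹ n * G k)                            ≈⟨ *-distribˡ-Σ n _ G ⟨
    uniform n G                                           ∎
    where
      open IsLinear (weighted-isLinear (PermDist.support μ))
      marginal-δ : ∀ k → Eperm μ (λ π → δ (π ⟨$⟩ʳ j) k) ≈ n⁻¹ n
      marginal-δ k = trans (sumL-map-cong (PermDist.support μ) λ x → *-comm (proj₂ x) _) (PermDist.marginal μ j k)

  uniform³ : ∀ n .{{_ : NonZero n}} → (Fin n → Fin n → Fin n → Carrier) → Carrier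
  uniform³ n G = uniform n (λ x → uniform n λ y → uniform n λ z → G x y z)

  Eperm³-marginal : ∀ {n} .{{_ : NonZero n}} (μ₁ μ₂ μ₃ : PermDist n) i q j (G : Fin n → Fin n → Fin n → Carrier) →
    Eperm μ₁ (λ π₁ → Eperm μ₂ λ π₂ → Eperm μ₃ λ π₃ → G (π₁ ⟨$⟩ʳ i) (π₂ ⟨$⟩ʳ q) (π₃ ⟨$⟩ʳ j))
      ≈ uniform³ n G
  Eperm³-marginal {n} μ₁ μ₂ μ₃ i q j G = begin
    Eperm μ₁ (λ π₁ → Eperm μ₂ λ π₂ → Eperm μ₃ λ π₃ → G (π₁ ⟨$⟩ʳ i) (π₂ ⟨$⟩ʳ q) (π₃ ⟨$⟩ʳ j))
      ≈⟨ E₁.E-cong (λ π₁ → E₂.E-cong λ π₂ → Eperm-marginal μ₃ j _) ⟩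
    Eperm μ₁ (λ π₁ → Eperm μ₂ λ π₂ → uniform n λ z → G (π₁ ⟨$⟩ʳ i) (π₂ ⟨$⟩ʳ q) z)
      ≈⟨ E₁.E-cong (λ π₁ → Eperm-marginal μ₂ q _) ⟩
    Eperm μ₁ (λ π₁ → uniform n λ y → uniform n λ z → G (π₁ ⟨$⟩ʳ i) y z)
      ≈⟨ Eperm-marginal μ₁ i _ ⟩
    uniform n (λ x → uniform n λ y → uniform n λ z → G x y z)
      ∎
    where
      module E₁ = IsLinear (weighted-isLinear (PermDist.support μ₁))
      module E₂ = IsLinear (weighted-isLinear (PermDist.support μ₂))

  uniform³-Σ : ∀ n .{{_ : NonZero n}} (G : Fin n → Fin n → Fin n → Carrier) →
    (n⁻¹ n * n⁻¹ n * n⁻¹ n) * (Σ[ n ] λ x → Σ[ n ] λ y → Σ[ n ] λ z → G x y z) ≈ uniform³ n G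
  uniform³-Σ n G = begin
    (ν * ν * ν) * (Σ[ n ] λ x → Σ[ n ] λ y → Σ[ n ] λ z → G x y z)     ≈⟨ trans (*-assoc _ _ _) (*-assoc _ _ _) ⟩
    ν * (ν * (ν * (Σ[ n ] λ x → Σ[ n ] λ y → Σ[ n ] λ z → G x y z)))   ≈⟨ *-congˡ (*-congˡ (*-distribˡ-Σ n ν _)) ⟩
    ν * (ν * (Σ[ n ] λ x → ν * Σ[ n ] λ y → Σ[ n ] λ z → G x y z))     ≈⟨ *-congˡ (trans (*-distribˡ-Σ n ν _) (Σ-cong n λ x → ×.x∙yz≈y∙xz ν ν _)) ⟩
    ν * (Σ[ n ] λ x → ν * (ν * Σ[ n ] λ y → Σ[ n ] λ z → G x y z))     ≈⟨ *-congˡ (Σ-cong n λ x → *-congˡ (*-distribˡ-Σ n ν _)) ⟩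
    uniform³ n G                                                     ∎
    where ν = n⁻¹ n

  -- The coefficient of A_{xy} B_{yz} in f(A, B)_{xz}; κ is the mean of 1 − brent over [n]³.
  brent : ∀ {n R} → Tensor n R → Tensor n R → Tensor n R → Fin n → Fin n → Fin n → Carrier
  brent {R = R} U V W x y z = Σ[ R ] λ r → U x y r * V y z r * W x z r

  1-κ≈uniform³-brent : ∀ {n R} .{{_ : NonZero n}} (U V W : Tensor n R) → 1# - κ U V W ≈ uniform³ n (brent U V W)
  1-κ≈uniform³-brent {n} U V W = begin
    1# - κ U V W                                       ≈⟨ +-congˡ (-‿cong (uniform³-Σ n _)) ⟩
    1# - uniform³ n (λ i j l → 1# - brent U V W i l j) ≈⟨ +-congˡ (-‿cong (E-sub (λ _ → 1#) _)) ⟩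
    1# - (uniform³ n (λ _ _ _ → 1#) - mean)            ≈⟨ +-congˡ (-‿cong (+-congʳ one)) ⟩
    1# - (1# - mean)                                   ≈⟨ +-congˡ (⁻¹-anti-homo‿- 1# mean) ⟩
    1# + (mean - 1#)                                   ≈⟨ trans (sym (+-assoc _ _ _)) (xyx⁻¹≈y 1# mean) ⟩
    mean                                               ≈⟨ Unif.E-cong (λ i → E-uniform-comm n (uniform-isLinear n) _) ⟩
    uniform³ n (brent U V W)                           ∎
    where
      mean = uniform³ n (λ i j l → brent U V W i l j)
      module Unif = IsLinear (uniform-isLinear n)
      open IsLinear (nested-isLinear (uniform-isLinear n) (nested-isLinear (uniform-isLinear n) (uniform-isLinear n)))
      one : uniform³ n (λ _ _ _ → 1#) ≈ 1#
      one = trans (Unif.E-cong λ _ → trans (Unif.E-cong λ _ → uniform-const n 1#) (uniform-const n 1#)) (uniform-const n 1#)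

  -- Averages over Rademacher signs

  half-+ : ∀ x → half * (x + x) ≈ x
  half-+ x = begin
    half * (x + x)         ≈⟨ *-congˡ (+-congˡ (+-identityʳ x)) ⟨
    half * Σ[ 2 ] (λ _ → x) ≈⟨ *-congˡ (Σ-const 2 x) ⟩
    half * (ℕ→ 2 * x)      ≈⟨ *-assoc _ _ _ ⟨
    half * ℕ→ 2 * x        ≈⟨ *-congʳ (trans (*-comm _ _) (inv-inverse (ℕ→ 2) (char0 1))) ⟩
    1# * x                 ≈⟨ *-identityˡ x ⟩
    x                      ∎

  Esign-isLinear : ∀ k → IsLinear (Esign k)
  Esign-isLinear zero    = record { E-cong = λ f≈g → f≈g _ ; E-+ = λ _ _ → refl ; E-*ˡ = λ _ _ → refl }
  Esign-isLinear (suc k) = scaled-isLinear half (record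
    { E-cong = λ f≈g → +-cong (E-cong λ s → f≈g (true ∷ᶠ s)) (E-cong λ s → f≈g (false ∷ᶠ s))
    ; E-+    = λ f g → trans (+-cong (E-+ _ _) (E-+ _ _)) (interchange _ _ _ _)
    ; E-*ˡ   = λ a f → trans (+-cong (E-*ˡ a _) (E-*ˡ a _)) (sym (distribˡ a _ _))
    })
    where open IsLinear (Esign-isLinear k)

  Esign-const : ∀ k x → Esign k (λ _ → x) ≈ x
  Esign-const zero    x = refl
  Esign-const (suc k) x = trans (*-congˡ (+-cong (Esign-const k x) (Esign-const k x))) (half-+ x)

  Esign-sgn : ∀ k p → Esign k (λ s → sgn (s p)) ≈ 0#
  Esign-sgn (suc k) fzero    = begin
    half * (Esign k (λ _ → 1#) + Esign k (λ _ → - 1#)) ≈⟨ *-congˡ (+-cong (Esign-const k 1#) (Esign-const k (- 1#))) ⟩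
    half * (1# - 1#)                                   ≈⟨ *-congˡ (-‿inverseʳ 1#) ⟩
    half * 0#                                          ≈⟨ zeroʳ half ⟩
    0#                                                 ∎
  Esign-sgn (suc k) (fsuc p) = trans (*-congˡ (+-cong (Esign-sgn k p) (Esign-sgn k p))) (half-+ 0#)

  Esign-sgn-sgn : ∀ k p q → Esign k (λ s → sgn (s p) * sgn (s q)) ≈ δ p q
  Esign-sgn-sgn (suc k) fzero    fzero    = begin
    half * (Esign k (λ _ → 1# * 1#) + Esign k (λ _ → - 1# * - 1#)) ≈⟨ *-congˡ (+-cong (Esign-const k _) (Esign-const k _)) ⟩
    half * (1# * 1# + - 1# * - 1#) ≈⟨ *-congˡ (+-cong (*-identityˡ 1#) (trans (-1*x≈-x (- 1#)) (-‿involutive 1#))) ⟩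
    half * (1# + 1#)               ≈⟨ half-+ 1# ⟩
    1#                             ∎
  Esign-sgn-sgn (suc k) fzero    (fsuc q) =
    trans (*-congˡ (+-cong (vanish 1#) (vanish (- 1#)))) (half-+ 0#)
    where
      open IsLinear (Esign-isLinear k)
      vanish : ∀ x → Esign k (λ s → x * sgn (s q)) ≈ 0#
      vanish x = trans (E-*ˡ x _) (trans (*-congˡ (Esign-sgn k q)) (zeroʳ x))
  Esign-sgn-sgn (suc k) (fsuc p) fzero    =
    trans (*-congˡ (+-cong (vanish 1#) (vanish (- 1#)))) (half-+ 0#)
    where
      open IsLinear (Esign-isLinear k)
      vanish : ∀ x → Esign k (λ s → sgn (s p) * x) ≈ 0#
      vanish x = trans (E-*ʳ x _) (trans (*-congʳ (Esign-sgn k p)) (zeroˡ x))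
  Esign-sgn-sgn (suc k) (fsuc p) (fsuc q) =
    trans (*-congˡ (+-cong (Esign-sgn-sgn k p q) (Esign-sgn-sgn k p q))) (half-+ (δ p q))

  module _ {k : ℕ} where

    ⟨_∣_⟩ : (Fin k → Bool) → (Fin k → Carrier) → Carrier
    ⟨ s ∣ u ⟩ = Σ[ k ] λ p → sgn (s p) * u p

    ⟪_∣_∣_⟫ : (Fin k → Bool) → (Fin k → Fin k → Carrier) → (Fin k → Bool) → Carrier
    ⟪ s ∣ a ∣ t ⟫ = ⟨ t ∣ (λ q → ⟨ s ∣ (λ p → a p q) ⟩) ⟩

    ⟨∣⟩-*ʳ : ∀ s u x → ⟨ s ∣ u ⟩ * x ≈ ⟨ s ∣ (λ p → u p * x) ⟩
    ⟨∣⟩-*ʳ s u x = trans (*-distribʳ-Σ k x _) (Σ-cong k λ p → *-assoc _ _ _)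

    E-⟨∣⟩ : ∀ {X : Set} {E : (X → Carrier) → Carrier} → IsLinear E → ∀ s (f : X → Fin k → Carrier) →
            E (λ x → ⟨ s ∣ f x ⟩) ≈ ⟨ s ∣ (λ p → E (λ x → f x p)) ⟩
    E-⟨∣⟩ L s f = trans (E-Σ k _) (Σ-cong k λ p → E-*ˡ (sgn (s p)) _)
      where open IsLinear L

    Esign-sgn-⟨∣⟩ : ∀ i u → Esign k (λ s → sgn (s i) * ⟨ s ∣ u ⟩) ≈ u i
    Esign-sgn-⟨∣⟩ i u = begin
      Esign k (λ s → sgn (s i) * ⟨ s ∣ u ⟩)                     ≈⟨ E-cong (λ s → *-distribˡ-Σ k _ _) ⟩
      Esign k (λ s → Σ[ k ] λ p → sgn (s i) * (sgn (s p) * u p)) ≈⟨ E-Σ k _ ⟩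
      Σ[ k ] (λ p → Esign k (λ s → sgn (s i) * (sgn (s p) * u p))) ≈⟨ Σ-cong k (λ p → trans (E-cong λ s → sym (*-assoc _ _ _)) (E-*ʳ (u p) _)) ⟩
      Σ[ k ] (λ p → Esign k (λ s → sgn (s i) * sgn (s p)) * u p) ≈⟨ Σ-cong k (λ p → *-congʳ (Esign-sgn-sgn k i p)) ⟩
      Σ[ k ] (λ p → δ i p * u p)                               ≈⟨ Σ-δˡ k i u ⟩
      u i                                                      ∎
      where open IsLinear (Esign-isLinear k)

    Esign-⟨∣⟩-sgn : ∀ u j → Esign k (λ s → ⟨ s ∣ u ⟩ * sgn (s j)) ≈ u j
    Esign-⟨∣⟩-sgn u j = trans (IsLinear.E-cong (Esign-isLinear k) λ s → *-comm _ _) (Esign-sgn-⟨∣⟩ j u)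

    Esign-⟨∣⟩-⟨∣⟩ : ∀ u v → Esign k (λ s → ⟨ s ∣ u ⟩ * ⟨ s ∣ v ⟩) ≈ Σ[ k ] (λ p → u p * v p)
    Esign-⟨∣⟩-⟨∣⟩ u v = begin
      Esign k (λ s → ⟨ s ∣ u ⟩ * ⟨ s ∣ v ⟩)                       ≈⟨ E-cong (λ s → ⟨∣⟩-*ʳ s u _) ⟩
      Esign k (λ s → Σ[ k ] λ p → sgn (s p) * (u p * ⟨ s ∣ v ⟩))  ≈⟨ E-Σ k _ ⟩
      Σ[ k ] (λ p → Esign k (λ s → sgn (s p) * (u p * ⟨ s ∣ v ⟩))) ≈⟨ Σ-cong k (λ p → trans (E-cong λ s → ×.x∙yz≈y∙xz _ _ _) (E-*ˡ (u p) _)) ⟩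
      Σ[ k ] (λ p → u p * Esign k (λ s → sgn (s p) * ⟨ s ∣ v ⟩))   ≈⟨ Σ-cong k (λ p → *-congˡ (Esign-sgn-⟨∣⟩ p v)) ⟩
      Σ[ k ] (λ p → u p * v p)                                  ∎
      where open IsLinear (Esign-isLinear k)

  -- Average out s₃, then s₂, then s₁, each time by E[s sᵀ] = I.
  Esign-sandwich : ∀ k (a b : Fin k → Fin k → Carrier) i j →
    Esign k (λ s₁ → Esign k λ s₂ → Esign k λ s₃ →
      (sgn (s₁ i) * (⟪ s₁ ∣ a ∣ s₂ ⟫ * ⟪ s₂ ∣ b ∣ s₃ ⟫)) * sgn (s₃ j))
      ≈ Σ[ k ] (λ q → a i q * b q j)
  Esign-sandwich k a b i j = begin
    Esign k (λ s₁ → Esign k λ s₂ → Esign k λ s₃ → (sgn (s₁ i) * (⟪ s₁ ∣ a ∣ s₂ ⟫ * ⟪ s₂ ∣ b ∣ s₃ ⟫)) * sgn (s₃ j))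
      ≈⟨ E-cong (λ s₁ → E-cong λ s₂ → average-s₃ (sgn (s₁ i)) ⟪ s₁ ∣ a ∣ s₂ ⟫ s₂) ⟩
    Esign k (λ s₁ → Esign k λ s₂ → sgn (s₁ i) * (⟪ s₁ ∣ a ∣ s₂ ⟫ * ⟨ s₂ ∣ (λ q → b q j) ⟩))
      ≈⟨ E-cong (λ s₁ → trans (E-*ˡ (sgn (s₁ i)) _) (*-congˡ (Esign-⟨∣⟩-⟨∣⟩ (λ q → ⟨ s₁ ∣ (λ p → a p q) ⟩) (λ q → b q j)))) ⟩
    Esign k (λ s₁ → sgn (s₁ i) * Σ[ k ] (λ q → ⟨ s₁ ∣ (λ p → a p q) ⟩ * b q j))
      ≈⟨ E-cong (λ s₁ → *-congˡ (trans (Σ-cong k λ q → ⟨∣⟩-*ʳ s₁ _ (b q j)) (E-⟨∣⟩ (Σ-isLinear k) s₁ _))) ⟩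
    Esign k (λ s₁ → sgn (s₁ i) * ⟨ s₁ ∣ (λ p → Σ[ k ] (λ q → a p q * b q j)) ⟩)
      ≈⟨ Esign-sgn-⟨∣⟩ i _ ⟩
    Σ[ k ] (λ q → a i q * b q j)
      ∎
    where
      open IsLinear (Esign-isLinear k)
      average-s₃ : ∀ x y s₂ → Esign k (λ s₃ → (x * (y * ⟪ s₂ ∣ b ∣ s₃ ⟫)) * sgn (s₃ j)) ≈ x * (y * ⟨ s₂ ∣ (λ q → b q j) ⟩)
      average-s₃ x y s₂ = begin
        Esign k (λ s₃ → (x * (y * ⟪ s₂ ∣ b ∣ s₃ ⟫)) * sgn (s₃ j)) ≈⟨ E-cong (λ s₃ → trans (*-assoc _ _ _) (*-congˡ (*-assoc _ _ _))) ⟩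
        Esign k (λ s₃ → x * (y * (⟪ s₂ ∣ b ∣ s₃ ⟫ * sgn (s₃ j)))) ≈⟨ trans (E-*ˡ x _) (*-congˡ (E-*ˡ y _)) ⟩
        x * (y * Esign k (λ s₃ → ⟪ s₂ ∣ b ∣ s₃ ⟫ * sgn (s₃ j)))    ≈⟨ *-congˡ (*-congˡ (Esign-⟨∣⟩-sgn _ j)) ⟩
        x * (y * ⟨ s₂ ∣ (λ q → b q j) ⟩)                          ∎

  -- Signed block permutation matrices

  module _ {n m : ℕ} (π : Permutation′ n) (s : Fin n → Bool) where

    private
      M : BMat n m
      M = Mmat π s

      bring-to-front : ∀ x y z w → (x * (y * z)) * w ≈ y * (x * (z * w))
      bring-to-front = ×-Solver.solve 4 (λ x y z w → ((x ⊕ (y ⊕ z)) ⊕ w) ⊜ (y ⊕ (x ⊕ (z ⊕ w)))) refl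

      bring-to-front′ : ∀ w x y z → w * (x * (y * z)) ≈ y * (x * (z * w))
      bring-to-front′ = ×-Solver.solve 4 (λ w x y z → (w ⊕ (x ⊕ (y ⊕ z))) ⊜ (y ⊕ (x ⊕ (z ⊕ w)))) refl

    Mmat-entry : ∀ p a q b → M p a q b ≈ δ (π ⟨$⟩ʳ q) p * (δ a b * sgn (s q))
    Mmat-entry p a q b = begin
      Σ[ n ] (λ k → Σ[ m ] λ e → (δ (π ⟨$⟩ʳ k) p * δ a e) * (δ k q * δ e b * sgn (s q)))
        ≈⟨ Σ-cong n (λ k → Σ-cong m λ e → regroup _ _ _ _ _) ⟩
      Σ[ n ] (λ k → Σ[ m ] λ e → δ e b * (δ k q * (δ (π ⟨$⟩ʳ k) p * (δ a e * sgn (s q)))))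
        ≈⟨ Σ-cong n (λ k → Σ-δʳ m b _) ⟩
      Σ[ n ] (λ k → δ k q * (δ (π ⟨$⟩ʳ k) p * (δ a b * sgn (s q))))
        ≈⟨ Σ-δʳ n q _ ⟩
      δ (π ⟨$⟩ʳ q) p * (δ a b * sgn (s q))
        ∎
      where
        regroup : ∀ x y z w v → (x * y) * (z * w * v) ≈ w * (z * (x * (y * v)))
        regroup = ×-Solver.solve 5 (λ x y z w v → ((x ⊕ y) ⊕ ((z ⊕ w) ⊕ v)) ⊜ (w ⊕ (z ⊕ (x ⊕ (y ⊕ v))))) refl

    M⊗-entry : ∀ (X : BMat n m) k a l b → (M ⊗ X) k a l b ≈ Σ[ n ] (λ p → δ (π ⟨$⟩ʳ p) k * (sgn (s p) * X p a l b))
    M⊗-entry X k a l b = Σ-cong n λ p → begin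
      Σ[ m ] (λ e → M k a p e * X p e l b)                                         ≈⟨ Σ-cong m (λ e → trans (*-congʳ (Mmat-entry k a p e)) (bring-to-front _ _ _ _)) ⟩
      Σ[ m ] (λ e → δ a e * (δ (π ⟨$⟩ʳ p) k * (sgn (s p) * X p e l b)))            ≈⟨ Σ-δˡ m a _ ⟩
      δ (π ⟨$⟩ʳ p) k * (sgn (s p) * X p a l b)                                     ∎

    ⊗Mᵀ-entry : ∀ (X : BMat n m) k a l b → (X ⊗ (M ᵀ)) k a l b ≈ Σ[ n ] (λ q → δ (π ⟨$⟩ʳ q) l * (sgn (s q) * X k a q b))
    ⊗Mᵀ-entry X k a l b = Σ-cong n λ q → begin
      Σ[ m ] (λ e → X k a q e * M l b q e)                                         ≈⟨ Σ-cong m (λ e → trans (*-congˡ (Mmat-entry l b q e)) (bring-to-front′ _ _ _ _)) ⟩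
      Σ[ m ] (λ e → δ b e * (δ (π ⟨$⟩ʳ q) l * (sgn (s q) * X k a q e)))            ≈⟨ Σ-δˡ m b _ ⟩
      δ (π ⟨$⟩ʳ q) l * (sgn (s q) * X k a q b)                                     ∎

    Mᵀ⊗-entry : ∀ (X : BMat n m) i a l b → ((M ᵀ) ⊗ X) i a l b ≈ sgn (s i) * X (π ⟨$⟩ʳ i) a l b
    Mᵀ⊗-entry X i a l b = begin
      Σ[ n ] (λ k → Σ[ m ] λ e → M k e i a * X k e l b)                           ≈⟨ Σ-cong n (λ k → Σ-cong m λ e → trans (*-congʳ (Mmat-entry k e i a)) (bring-to-front _ _ _ _)) ⟩
      Σ[ n ] (λ k → Σ[ m ] λ e → δ e a * (δ (π ⟨$⟩ʳ i) k * (sgn (s i) * X k e l b))) ≈⟨ Σ-cong n (λ k → Σ-δʳ m a _) ⟩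
      Σ[ n ] (λ k → δ (π ⟨$⟩ʳ i) k * (sgn (s i) * X k a l b))                     ≈⟨ Σ-δˡ n _ _ ⟩
      sgn (s i) * X (π ⟨$⟩ʳ i) a l b                                              ∎

    ⊗M-entry : ∀ (X : BMat n m) i a j b → (X ⊗ M) i a j b ≈ X i a (π ⟨$⟩ʳ j) b * sgn (s j)
    ⊗M-entry X i a j b = begin
      Σ[ n ] (λ l → Σ[ m ] λ e → X i a l e * M l e j b)                           ≈⟨ Σ-cong n (λ l → Σ-cong m λ e → trans (*-congˡ (Mmat-entry l e j b)) (bring-to-front′ _ _ _ _)) ⟩
      Σ[ n ] (λ l → Σ[ m ] λ e → δ e b * (δ (π ⟨$⟩ʳ j) l * (sgn (s j) * X i a l e))) ≈⟨ Σ-cong n (λ l → Σ-δʳ m b _) ⟩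
      Σ[ n ] (λ l → δ (π ⟨$⟩ʳ j) l * (sgn (s j) * X i a l b))                     ≈⟨ Σ-δˡ n _ _ ⟩
      sgn (s j) * X i a (π ⟨$⟩ʳ j) b                                              ≈⟨ *-comm _ _ ⟩
      X i a (π ⟨$⟩ʳ j) b * sgn (s j)                                              ∎

    pairing-M⊗ : ∀ (g : Fin n → Carrier) (X : BMat n m) a l b →
                 Σ[ n ] (λ k → g k * (M ⊗ X) k a l b) ≈ ⟨ s ∣ (λ p → g (π ⟨$⟩ʳ p) * X p a l b) ⟩
    pairing-M⊗ g X a l b = begin
      Σ[ n ] (λ k → g k * (M ⊗ X) k a l b)                                ≈⟨ Σ-cong n (λ k → *-congˡ (M⊗-entry X k a l b)) ⟩
      Σ[ n ] (λ k → g k * Σ[ n ] (λ p → δ (π ⟨$⟩ʳ p) k * (sgn (s p) * X p a l b))) ≈⟨ Σ-δ-reindex n (π ⟨$⟩ʳ_) g _ ⟩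
      Σ[ n ] (λ p → g (π ⟨$⟩ʳ p) * (sgn (s p) * X p a l b))                ≈⟨ Σ-cong n (λ p → ×.x∙yz≈y∙xz _ _ _) ⟩
      ⟨ s ∣ (λ p → g (π ⟨$⟩ʳ p) * X p a l b) ⟩                            ∎

    pairing-⊗Mᵀ : ∀ (g : Fin n → Carrier) (X : BMat n m) k a b →
                  Σ[ n ] (λ l → g l * (X ⊗ (M ᵀ)) k a l b) ≈ ⟨ s ∣ (λ q → g (π ⟨$⟩ʳ q) * X k a q b) ⟩
    pairing-⊗Mᵀ g X k a b = begin
      Σ[ n ] (λ l → g l * (X ⊗ (M ᵀ)) k a l b)                            ≈⟨ Σ-cong n (λ l → *-congˡ (⊗Mᵀ-entry X k a l b)) ⟩
      Σ[ n ] (λ l → g l * Σ[ n ] (λ q → δ (π ⟨$⟩ʳ q) l * (sgn (s q) * X k a q b))) ≈⟨ Σ-δ-reindex n (π ⟨$⟩ʳ_) g _ ⟩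
      Σ[ n ] (λ q → g (π ⟨$⟩ʳ q) * (sgn (s q) * X k a q b))                ≈⟨ Σ-cong n (λ q → ×.x∙yz≈y∙xz _ _ _) ⟩
      ⟨ s ∣ (λ q → g (π ⟨$⟩ʳ q) * X k a q b) ⟩                            ∎

  conjugate-pairing : ∀ {n m} (u : Fin n → Fin n → Carrier) π s π′ s′ (Z : BMat n m) a e →
    Σ[ n ] (λ k → Σ[ n ] λ l → u k l * ((Mmat π s ⊗ Z) ⊗ (Mmat π′ s′ ᵀ)) k a l e)
      ≈ ⟪ s ∣ (λ p q → u (π ⟨$⟩ʳ p) (π′ ⟨$⟩ʳ q) * Z p a q e) ∣ s′ ⟫
  conjugate-pairing {n} u π s π′ s′ Z a e = begin
    Σ[ n ] (λ k → Σ[ n ] λ l → u k l * (Y ⊗ (Mmat π′ s′ ᵀ)) k a l e) ≈⟨ Σ-cong n (λ k → pairing-⊗Mᵀ π′ s′ (u k) Y k a e) ⟩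
    Σ[ n ] (λ k → ⟨ s′ ∣ (λ q → u k (π′ ⟨$⟩ʳ q) * Y k a q e) ⟩)     ≈⟨ E-⟨∣⟩ (Σ-isLinear n) s′ _ ⟩
    ⟨ s′ ∣ (λ q → Σ[ n ] λ k → u k (π′ ⟨$⟩ʳ q) * Y k a q e) ⟩       ≈⟨ Σ-cong n (λ q → *-congˡ (pairing-M⊗ π s (λ k → u k (π′ ⟨$⟩ʳ q)) Z a q e)) ⟩
    ⟪ s ∣ (λ p q → u (π ⟨$⟩ʳ p) (π′ ⟨$⟩ʳ q) * Z p a q e) ∣ s′ ⟫    ∎
    where Y = Mmat π s ⊗ Z

  module _ {n R m : ℕ} (U V W : Tensor n R) (c⁻¹ : Carrier) (A B : BMat n m)
           (π₁ π₂ π₃ : Permutation′ n) (i : Fin n) (a : Fin m) (j : Fin n) (b : Fin m) where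

    private
      x = π₁ ⟨$⟩ʳ i
      z = π₃ ⟨$⟩ʳ j

      α : Fin R → Fin m → Fin n → Fin n → Carrier
      α r e p q = U (π₁ ⟨$⟩ʳ p) (π₂ ⟨$⟩ʳ q) r * A p a q e

      β : Fin R → Fin m → Fin n → Fin n → Carrier
      β r e p q = V (π₂ ⟨$⟩ʳ p) (π₃ ⟨$⟩ʳ q) r * B p e q b

    collect-brent : Σ[ R ] (λ r → W x z r * Σ[ m ] λ e → Σ[ n ] λ q → α r e i q * β r e q j)
                    ≈ Σ[ n ] (λ q → Σ[ m ] λ e → (A i a q e * B q e j b) * brent U V W x (π₂ ⟨$⟩ʳ q) z)
    collect-brent = begin
      Σ[ R ] (λ r → W x z r * Σ[ m ] λ e → Σ[ n ] λ q → α r e i q * β r e q j)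
        ≈⟨ Σ-cong R (λ r → trans (*-distribˡ-Σ m _ _) (Σ-cong m λ e → *-distribˡ-Σ n _ _)) ⟩
      Σ[ R ] (λ r → Σ[ m ] λ e → Σ[ n ] λ q → W x z r * (α r e i q * β r e q j))
        ≈⟨ trans (Σ-cong R λ r → Σ-comm m n _) (trans (Σ-comm R n _) (Σ-cong n λ q → Σ-comm R m _)) ⟩
      Σ[ n ] (λ q → Σ[ m ] λ e → Σ[ R ] λ r → W x z r * (α r e i q * β r e q j))
        ≈⟨ Σ-cong n (λ q → Σ-cong m λ e → Σ-cong R λ r → factor _ _ _ _ _) ⟩
      Σ[ n ] (λ q → Σ[ m ] λ e → Σ[ R ] λ r → (A i a q e * B q e j b) * (U x (π₂ ⟨$⟩ʳ q) r * V (π₂ ⟨$⟩ʳ q) z r * W x z r))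
        ≈⟨ Σ-cong n (λ q → Σ-cong m λ e → *-distribˡ-Σ R _ _) ⟨
      Σ[ n ] (λ q → Σ[ m ] λ e → (A i a q e * B q e j b) * brent U V W x (π₂ ⟨$⟩ʳ q) z)
        ∎
      where
        factor : ∀ w u p v t → w * ((u * p) * (v * t)) ≈ (p * t) * (u * v * w)
        factor = ×-Solver.solve 5 (λ w u p v t → (w ⊕ ((u ⊕ p) ⊕ (v ⊕ t))) ⊜ ((p ⊕ t) ⊕ ((u ⊕ v) ⊕ w))) refl

    fHat-entry : ∀ s₁ s₂ s₃ → fHat U V W c⁻¹ π₁ π₂ π₃ s₁ s₂ s₃ A B i a j b ≈
      c⁻¹ * Σ[ R ] (λ r → W x z r * Σ[ m ] λ e →
        (sgn (s₁ i) * (⟪ s₁ ∣ α r e ∣ s₂ ⟫ * ⟪ s₂ ∣ β r e ∣ s₃ ⟫)) * sgn (s₃ j))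
    fHat-entry s₁ s₂ s₃ = *-congˡ (begin
      (((M₁ ᵀ) ⊗ F) ⊗ M₃) i a j b                    ≈⟨ ⊗M-entry π₃ s₃ ((M₁ ᵀ) ⊗ F) i a j b ⟩
      ((M₁ ᵀ) ⊗ F) i a z b * sgn (s₃ j)               ≈⟨ *-congʳ (Mᵀ⊗-entry π₁ s₁ F i a z b) ⟩
      (sgn (s₁ i) * F x a z b) * sgn (s₃ j)           ≈⟨ *-congʳ (*-congˡ (Σ-cong R λ r → *-congˡ (Σ-cong m λ e → *-cong
                                                           (conjugate-pairing _ π₁ s₁ π₂ s₂ A a e) (conjugate-pairing _ π₂ s₂ π₃ s₃ B e b)))) ⟩
      (sgn (s₁ i) * Σ[ R ] (λ r → W x z r * Σ[ m ] λ e → ⟪ s₁ ∣ α r e ∣ s₂ ⟫ * ⟪ s₂ ∣ β r e ∣ s₃ ⟫)) * sgn (s₃ j)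
                                                      ≈⟨ distribute (sgn (s₁ i)) (sgn (s₃ j)) ⟩
      Σ[ R ] (λ r → W x z r * Σ[ m ] λ e → (sgn (s₁ i) * (⟪ s₁ ∣ α r e ∣ s₂ ⟫ * ⟪ s₂ ∣ β r e ∣ s₃ ⟫)) * sgn (s₃ j)) ∎)
      where
        M₁ = Mmat π₁ s₁
        M₂ = Mmat π₂ s₂
        M₃ = Mmat π₃ s₃
        F = fAlg U V W ((M₁ ⊗ A) ⊗ (M₂ ᵀ)) ((M₂ ⊗ B) ⊗ (M₃ ᵀ))
        distribute : ∀ {w : Fin R → Carrier} {t : Fin R → Fin m → Carrier} σ τ →
          (σ * Σ[ R ] (λ r → w r * Σ[ m ] (t r))) * τ ≈ Σ[ R ] (λ r → w r * Σ[ m ] λ e → (σ * t r e) * τ)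
        distribute {w} {t} σ τ = begin
          (σ * Σ[ R ] (λ r → w r * Σ[ m ] (t r))) * τ          ≈⟨ *-congʳ (*-distribˡ-Σ R σ _) ⟩
          Σ[ R ] (λ r → σ * (w r * Σ[ m ] (t r))) * τ          ≈⟨ *-distribʳ-Σ R τ _ ⟩
          Σ[ R ] (λ r → (σ * (w r * Σ[ m ] (t r))) * τ)        ≈⟨ Σ-cong R (λ r → trans (*-congʳ (×.x∙yz≈y∙xz σ (w r) _)) (*-assoc _ _ _)) ⟩
          Σ[ R ] (λ r → w r * ((σ * Σ[ m ] (t r)) * τ))        ≈⟨ Σ-cong R (λ r → *-congˡ (trans (*-congʳ (*-distribˡ-Σ m σ _)) (*-distribʳ-Σ m τ _))) ⟩
          Σ[ R ] (λ r → w r * Σ[ m ] λ e → (σ * t r e) * τ)    ∎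

    sign-average :
      Esign n (λ s₁ → Esign n λ s₂ → Esign n λ s₃ → fHat U V W c⁻¹ π₁ π₂ π₃ s₁ s₂ s₃ A B i a j b)
        ≈ c⁻¹ * Σ[ n ] (λ q → Σ[ m ] λ e → (A i a q e * B q e j b) * brent U V W x (π₂ ⟨$⟩ʳ q) z)
    sign-average = begin
      signs (λ (s₁ , s₂ , s₃) → fHat U V W c⁻¹ π₁ π₂ π₃ s₁ s₂ s₃ A B i a j b)
        ≈⟨ E-cong (λ (s₁ , s₂ , s₃) → fHat-entry s₁ s₂ s₃) ⟩
      signs (λ (s₁ , s₂ , s₃) → c⁻¹ * Σ[ R ] λ r → W x z r * Σ[ m ] λ e → sandwich r e s₁ s₂ s₃)
        ≈⟨ E-*ˡ c⁻¹ _ ⟩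
      c⁻¹ * signs (λ (s₁ , s₂ , s₃) → Σ[ R ] λ r → W x z r * Σ[ m ] λ e → sandwich r e s₁ s₂ s₃)
        ≈⟨ *-congˡ (trans (E-Σ R _) (Σ-cong R λ r → trans (E-*ˡ (W x z r) _) (*-congˡ (E-Σ m _)))) ⟩
      c⁻¹ * Σ[ R ] (λ r → W x z r * Σ[ m ] λ e → signs (λ (s₁ , s₂ , s₃) → sandwich r e s₁ s₂ s₃))
        ≈⟨ *-congˡ (Σ-cong R λ r → *-congˡ (Σ-cong m λ e → Esign-sandwich n (α r e) (β r e) i j)) ⟩
      c⁻¹ * Σ[ R ] (λ r → W x z r * Σ[ m ] λ e → Σ[ n ] λ q → α r e i q * β r e q j)
        ≈⟨ *-congˡ collect-brent ⟩
      c⁻¹ * Σ[ n ] (λ q → Σ[ m ] λ e → (A i a q e * B q e j b) * brent U V W x (π₂ ⟨$⟩ʳ q) z)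
        ∎
      where
        signs = nested (Esign n) (nested (Esign n) (Esign n))
        open IsLinear (nested-isLinear (Esign-isLinear n) (nested-isLinear (Esign-isLinear n) (Esign-isLinear n)))
        sandwich : Fin R → Fin m → (Fin n → Bool) → (Fin n → Bool) → (Fin n → Bool) → Carrier
        sandwich r e s₁ s₂ s₃ = (sgn (s₁ i) * (⟪ s₁ ∣ α r e ∣ s₂ ⟫ * ⟪ s₂ ∣ β r e ∣ s₃ ⟫)) * sgn (s₃ j)

proposition1 : ∀ {c ℓ : Level} (𝔽 : OrderedField c ℓ) →
    let open FieldDefs 𝔽 in
    (n R m : ℕ) → .{{_ : NonZero n}} → .{{_ : NonZero R}} → .{{_ : NonZero m}} →
    (U V W : Tensor n R) →
    (hκ : ¬ (κ U V W ≈ 1#)) →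
    (μ₁ μ₂ μ₃ : PermDist n) →
    (A B : BMat n m) →
    ∀ (i : Fin n) (a : Fin m) (j : Fin n) (b : Fin m) →
      EfHat U V W (inv (1# - κ U V W) (1-κ≉0 hκ)) μ₁ μ₂ μ₃ A B i a j b
        ≈ (A ⊗ B) i a j b
proposition1 𝔽 n R m U V W hκ μ₁ μ₂ μ₃ A B i a j b = begin
  perms (λ (π₁ , π₂ , π₃) → Esign n λ s₁ → Esign n λ s₂ → Esign n λ s₃ → fHat U V W c⁻¹ π₁ π₂ π₃ s₁ s₂ s₃ A B i a j b)
    ≈⟨ E-cong (λ (π₁ , π₂ , π₃) → sign-average U V W c⁻¹ A B π₁ π₂ π₃ i a j b) ⟩
  perms (λ (π₁ , π₂ , π₃) → c⁻¹ * Σ[ n ] λ q → Σ[ m ] λ e → AB q e * brent U V W (π₁ ⟨$⟩ʳ i) (π₂ ⟨$⟩ʳ q) (π₃ ⟨$⟩ʳ j))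
    ≈⟨ trans (E-*ˡ c⁻¹ _) (*-congˡ (trans (E-Σ n _) (Σ-cong n λ q → trans (E-Σ m _) (Σ-cong m λ e → E-*ˡ (AB q e) _)))) ⟩
  c⁻¹ * Σ[ n ] (λ q → Σ[ m ] λ e → AB q e * perms (λ (π₁ , π₂ , π₃) → brent U V W (π₁ ⟨$⟩ʳ i) (π₂ ⟨$⟩ʳ q) (π₃ ⟨$⟩ʳ j)))
    ≈⟨ *-congˡ (Σ-cong n λ q → Σ-cong m λ e → *-congˡ (trans (Eperm³-marginal μ₁ μ₂ μ₃ i q j _) (sym (1-κ≈uniform³-brent U V W)))) ⟩
  c⁻¹ * Σ[ n ] (λ q → Σ[ m ] λ e → AB q e * (1# - κ U V W))
    ≈⟨ *-congˡ (trans (*-distribʳ-Σ n _ _) (Σ-cong n λ q → *-distribʳ-Σ m _ _)) ⟨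
  c⁻¹ * ((A ⊗ B) i a j b * (1# - κ U V W))
    ≈⟨ ×.x∙yz≈y∙zx c⁻¹ _ _ ⟩
  (A ⊗ B) i a j b * ((1# - κ U V W) * c⁻¹)
    ≈⟨ *-congˡ (inv-inverse (1# - κ U V W) (1-κ≉0 hκ)) ⟩
  (A ⊗ B) i a j b * 1#
    ≈⟨ *-identityʳ _ ⟩
  (A ⊗ B) i a j b
    ∎
  where
    open FieldDefs 𝔽
    open UnbiasedAlgorithm 𝔽
    open Relation.Binary.Reasoning.Setoid setoid
    c⁻¹ = inv (1# - κ U V W) (1-κ≉0 hκ)
    AB = λ q e → A i a q e * B q e j b
    perms = nested (Eperm μ₁) (nested (Eperm μ₂) (Eperm μ₃))
    open IsLinear (nested-isLinear (weighted-isLinear (PermDist.support μ₁))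
                    (nested-isLinear (weighted-isLinear (PermDist.support μ₂)) (weighted-isLinear (PermDist.support μ₃))))
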